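{- For every integer $n\ge 2$, the mixed graph $F(n)$ has diameter $2n$.
   Context: A mixed graph has a vertex set, a set of (undirected) edges and a set of arcs (ordered pairs of vertices). A walk may traverse an edge in either direction and an arc only from its tail to its head. The distance $\mathrm{dist}(u,v)$ is the length of a shortest walk from $u$ to $v$ (not necessarily symmetric), and the diameter is the maximum of $\mathrm{dist}(u,v)$ over all ordered pairs of vertices. For $n\ge 2$, the mixed graph $F(n)$ has vertex set consisting of all labels $a:x_1x_2\ldots x_n$ with $a\in\{+1,-1\}$, $x_i\in\mathbb{Z}_3$, and $x_{i+1}\neq x_i$ for $i=1,\ldots,n-1$ (so $3\cdot 2^n$ vertices). Its edges join $a:x_1x_2\ldots x_n$ and $-a:x_1x_2\ldots x_n$, and its arcs go from $a:x_1x_2\ldots x_n$ to $a:x_2x_3\ldots x_n(x_n+a)$, with arithmetic in $\mathbb{Z}_3$. -}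

module Defs where

open import Data.Nat using (ℕ; zero; suc; _≤_)
open import Data.Bool using (Bool; true; false; not; _∧_; T)
open import Data.Fin using (Fin; zero; suc; _≟_)
open import Data.Vec using (Vec; []; _∷_; _∷ʳ_; last)
open import Data.Product using (Σ; _×_; _,_; ∃; ∃-syntax)
open import Data.Sum using (_⊎_)
open import Relation.Binary.PropositionalEquality using (_≡_)
open import Relation.Nullary.Decidable using (⌊_⌋)

record MixedGraph : Set₁ where
  field
    V    : Set
    Edge : V → V → Set
    Arc  : V → V → Set

module _ (G : MixedGraph) where
  open MixedGraph G

  Step : V → V → Set
  Step u v = Edge u v ⊎ Edge v u ⊎ Arc u v

  data Walk : ℕ → V → V → Set where
    here : ∀ {u} → Walk zero u u
    _∷w_ : ∀ {k u v w} → Step u v → Walk k v w → Walk (suc k) u w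

  IsDist : V → V → ℕ → Set
  IsDist u v d = Walk d u v × (∀ k → Walk k u v → d ≤ k)

  HasDiameter : ℕ → Set
  HasDiameter D =
    (∀ u v → ∃[ d ] (IsDist u v d × d ≤ D)) ×
    (∃[ u ] ∃[ v ] IsDist u v D)

-- sign: true = +1, false = -1
Sign : Set
Sign = Bool

-- x ↦ x + a in ℤ₃ (a = +1 if true, -1 if false)
addSign : Sign → Fin 3 → Fin 3
addSign true  zero             = suc zero
addSign true  (suc zero)       = suc (suc zero)
addSign true  (suc (suc zero)) = zero
addSign false zero             = suc (suc zero)
addSign false (suc zero)       = zero
addSign false (suc (suc zero)) = suc zero

proper : ∀ {n} → Vec (Fin 3) n → Bool
proper []               = true
proper (x ∷ [])         = true
proper (x ∷ y ∷ xs)     = not ⌊ x ≟ y ⌋ ∧ proper (y ∷ xs)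

shift : ∀ {n} → Sign → Vec (Fin 3) n → Vec (Fin 3) n
shift a []       = []
shift a (x ∷ xs) = xs ∷ʳ addSign a (last (x ∷ xs))

record FVertex (n : ℕ) : Set where
  constructor _∶_⟨_⟩
  field
    sign   : Sign
    word   : Vec (Fin 3) n
    isProper : T (proper word)
open FVertex public

F : ℕ → MixedGraph
F n = record
  { V    = FVertex n
  ; Edge = λ u v → sign v ≡ not (sign u) × word v ≡ word u
  ; Arc  = λ u v → sign v ≡ sign u × word v ≡ shift (sign u) (word u)
  }

-- Lower bound: let the run of a word be the length of its longest suffix that starts with 1 and
-- avoids 2.  The potential "ready + weight run" (ready ∈ {0,1}, weight 0 = 1, weight r = 2r)
-- grows by at most one along every edge and arc.  It equals 1 at the vertex with word 0202…
-- and the non-ready sign, and 2n + 1 at the vertex with word 1010… and the ready sign, so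
-- these two vertices are at distance at least 2n.
--
-- Upper bound: n arcs overwrite the whole word, and the sign of the arc writing z after c is
-- forced, so writing the target word y after the last letter c of the source costs n arcs
-- plus at most n + 1 flips.  One flip is saved: either c = y₁ and only n − 1 letters are
-- needed, or the first two sign changes are not both forced, or else writing first the third
-- letter t ∉ {c, y₁} makes the arcs c → t → y₁ share one sign.

module Submission where

open import Defs
open import Data.Nat using (ℕ; zero; suc; _+_; _*_; _≤_; _<_; z≤n; s≤s)
open import Data.Nat.Properties
  using (≤-refl; ≤-reflexive; ≤-trans; ≤-antisym; ≤-pred; <⇒≤; ≮⇒≥; n≤1+n; m≤m+n;
         +-suc; +-identityʳ; +-monoˡ-≤; +-monoʳ-≤; *-suc; *-monoʳ-≤; anyUpTo?; module ≤-Reasoning)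
open import Data.Nat.Induction using (<-rec)
open import Data.Bool using (true; false; not; T)
open import Data.Bool.Properties using (T-irrelevant; not-involutive) renaming (_≟_ to _≟ᵇ_)
open import Data.Fin using (Fin; zero; suc; _≟_)
open import Data.Vec using (Vec; []; _∷_; _∷ʳ_; last; toList; foldl′)
open import Data.Vec.Properties using (≡-dec; last-∷ʳ; foldl-∷ʳ; toList-∷ʳ; toList-injective; cast-is-id)
open import Data.List as List using (List; drop; _++_; [_])
open import Data.List.Properties using (++-assoc; ++-identityʳ)
open import Data.List.Relation.Unary.Any using (Any; here; there; any?)
open import Data.List.Membership.Propositional using (_∈_; find; lose)
open import Data.Product using (∃-syntax; _×_; _,_; proj₁; proj₂)
open import Data.Sum using (_⊎_; inj₁; inj₂)
open import Function using (_∘_)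
open import Relation.Nullary using (Dec; yes; no; contradiction)
open import Relation.Nullary.Decidable using (map′; _×-dec_)
open import Relation.Binary.Definitions using (DecidableEquality)
open import Relation.Binary.PropositionalEquality
  using (_≡_; _≢_; refl; sym; trans; cong; cong₂; subst; subst₂; module ≡-Reasoning)

module _ {G : MixedGraph} where
  open MixedGraph G using (V)

  _++ʷ_ : ∀ {a b} {u v w : V} → Walk G a u v → Walk G b v w → Walk G (a + b) u w
  here       ++ʷ q = q
  (st ∷w p)  ++ʷ q = st ∷w (p ++ʷ q)

  walk-potential-≤ : (Φ : V → ℕ) → (∀ u v → Step G u v → Φ v ≤ suc (Φ u)) →
                     ∀ {k u v} → Walk G k u v → Φ v ≤ Φ u + k
  walk-potential-≤ Φ gain-≤ here = m≤m+n _ 0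
  walk-potential-≤ Φ gain-≤ {suc k} {u} {v} (_∷w_ {v = w} st p) = begin
    Φ v           ≤⟨ walk-potential-≤ Φ gain-≤ p ⟩
    Φ w + k       ≤⟨ +-monoˡ-≤ k (gain-≤ u w st) ⟩
    suc (Φ u) + k ≡⟨ +-suc (Φ u) k ⟨
    Φ u + suc k   ∎
    where open ≤-Reasoning

  module _ (_≟ᵛ_ : DecidableEquality V) (next : V → List V)
           (next⇒step : ∀ {u v} → v ∈ next u → Step G u v)
           (step⇒next : ∀ {u v} → Step G u v → v ∈ next u) where

    walk? : ∀ k u v → Dec (Walk G k u v)
    walk? zero    u v = map′ (λ { refl → here }) (λ { here → refl }) (u ≟ᵛ v)
    walk? (suc k) u v = map′ from to (any? (λ w → walk? k w v) (next u))
      where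
      from : Any (λ w → Walk G k w v) (next u) → Walk G (suc k) u v
      from p with find p
      ... | _ , w∈next , q = next⇒step w∈next ∷w q
      to : Walk G (suc k) u v → Any (λ w → Walk G k w v) (next u)
      to (st ∷w q) = lose (step⇒next st) q

module _ {P : ℕ → Set} (P? : ∀ k → Dec (P k)) where

  least : ∀ L → P L → ∃[ d ] ((P d × (∀ k → P k → d ≤ k)) × d ≤ L)
  least = <-rec _ step
    where
    step : ∀ L → (∀ {j} → j < L → P j → ∃[ d ] ((P d × (∀ k → P k → d ≤ k)) × d ≤ j)) →
           P L → ∃[ d ] ((P d × (∀ k → P k → d ≤ k)) × d ≤ L)
    step L rec pL with anyUpTo? P? L
    ... | yes (j , j<L , pj) = let d , minimal , d≤j = rec j<L pj in d , minimal , ≤-trans d≤j (<⇒≤ j<L)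
    ... | no none            = L , (pL , λ k pk → ≮⇒≥ λ k<L → none (k , k<L , pk)) , ≤-refl

pattern one = suc zero
pattern two = suc (suc zero)

flips : Sign → Sign → ℕ
flips true  true  = 0
flips true  false = 1
flips false true  = 1
flips false false = 0

flips-≤1 : ∀ a b → flips a b ≤ 1
flips-≤1 true  true  = z≤n
flips-≤1 true  false = ≤-refl
flips-≤1 false true  = ≤-refl
flips-≤1 false false = z≤n

flips-refl : ∀ a → flips a a ≡ 0
flips-refl true  = refl
flips-refl false = refl

flips-not : ∀ a → flips a (not a) ≡ 1
flips-not true  = refl
flips-not false = refl

addSign-≢ : ∀ s c → c ≢ addSign s c
addSign-≢ true  zero ()
addSign-≢ true  one  ()
addSign-≢ true  two  ()
addSign-≢ false zero ()
addSign-≢ false one  ()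
addSign-≢ false two  ()

-- The sign of the arc that writes z after c; its value for c ≡ z is never used.
signFor : Fin 3 → Fin 3 → Sign
signFor zero one  = true
signFor zero two  = false
signFor one  zero = false
signFor one  two  = true
signFor two  zero = true
signFor two  one  = false
signFor _    _    = true

addSign-signFor : ∀ {c z} → c ≢ z → addSign (signFor c z) c ≡ z
addSign-signFor {zero} {zero} c≢z = contradiction refl c≢z
addSign-signFor {zero} {one}  _   = refl
addSign-signFor {zero} {two}  _   = refl
addSign-signFor {one}  {zero} _   = refl
addSign-signFor {one}  {one}  c≢z = contradiction refl c≢z
addSign-signFor {one}  {two}  _   = refl
addSign-signFor {two}  {zero} _   = refl
addSign-signFor {two}  {one}  _   = refl
addSign-signFor {two}  {two}  c≢z = contradiction refl c≢z

third : Fin 3 → Fin 3 → Fin 3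
third zero one  = two
third zero two  = one
third one  zero = two
third one  two  = zero
third two  zero = one
third two  one  = zero
third _    _    = zero

third-spec : ∀ {c y} → c ≢ y →
             c ≢ third c y × third c y ≢ y ×
             signFor c (third c y) ≡ not (signFor c y) × signFor (third c y) y ≡ not (signFor c y)
third-spec {zero} {zero} c≢y = contradiction refl c≢y
third-spec {zero} {one}  _   = (λ ()) , (λ ()) , refl , refl
third-spec {zero} {two}  _   = (λ ()) , (λ ()) , refl , refl
third-spec {one}  {zero} _   = (λ ()) , (λ ()) , refl , refl
third-spec {one}  {one}  c≢y = contradiction refl c≢y
third-spec {one}  {two}  _   = (λ ()) , (λ ()) , refl , refl
third-spec {two}  {zero} _   = (λ ()) , (λ ()) , refl , refl
third-spec {two}  {one}  _   = (λ ()) , (λ ()) , refl , refl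
third-spec {two}  {two}  c≢y = contradiction refl c≢y

module _ {a} {A : Set a} where

  push : ∀ {n} → Vec A (suc n) → A → Vec A (suc n)
  push (x ∷ xs) z = xs ∷ʳ z

  pushAll : ∀ {n k} → Vec A (suc n) → Vec A k → Vec A (suc n)
  pushAll w []       = w
  pushAll w (z ∷ zs) = pushAll (push w z) zs

  last-push : ∀ {n} (w : Vec A (suc n)) z → last (push w z) ≡ z
  last-push (x ∷ xs) z = last-∷ʳ z xs

  toList-pushAll : ∀ {n k} (w : Vec A (suc n)) (zs : Vec A k) →
                   toList (pushAll w zs) ≡ drop k (toList w ++ toList zs)
  toList-pushAll w        []       = sym (++-identityʳ (toList w))
  toList-pushAll {k = suc k} (x ∷ xs) (z ∷ zs) = begin
    toList (pushAll (xs ∷ʳ z) zs)                 ≡⟨ toList-pushAll (xs ∷ʳ z) zs ⟩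
    drop k (toList (xs ∷ʳ z) ++ toList zs)        ≡⟨ cong (λ l → drop k (l ++ toList zs)) (toList-∷ʳ z xs) ⟩
    drop k ((toList xs ++ [ z ]) ++ toList zs)    ≡⟨ cong (drop k) (++-assoc (toList xs) [ z ] (toList zs)) ⟩
    drop k (toList xs ++ z List.∷ toList zs)      ∎
    where open ≡-Reasoning

  drop-toList-++ : ∀ {k} (w : Vec A (suc k)) (l : List A) → drop k (toList w ++ l) ≡ last w List.∷ l
  drop-toList-++ (x ∷ [])     l = refl
  drop-toList-++ (x ∷ y ∷ ys) l = drop-toList-++ (y ∷ ys) l

  pushAll-last : ∀ {k} (w : Vec A (suc k)) (zs : Vec A k) → pushAll w zs ≡ last w ∷ zs
  pushAll-last w zs = trans (sym (cast-is-id refl (pushAll w zs)))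
    (toList-injective refl (pushAll w zs) (last w ∷ zs)
      (trans (toList-pushAll w zs) (drop-toList-++ w (toList zs))))

  pushAll-replace : ∀ {k} (w y : Vec A (suc k)) → pushAll w y ≡ y
  pushAll-replace w (y ∷ ys) = trans (pushAll-last (push w y) ys) (cong (_∷ ys) (last-push w y))

proper-∷⁺ : ∀ {n x y} (xs : Vec (Fin 3) n) → x ≢ y → T (proper (y ∷ xs)) → T (proper (x ∷ y ∷ xs))
proper-∷⁺ {x = x} {y} _ x≢y p with x ≟ y
... | yes x≡y = contradiction x≡y x≢y
... | no _    = p

proper-∷⁻ : ∀ {n} x y (xs : Vec (Fin 3) n) → T (proper (x ∷ y ∷ xs)) → x ≢ y × T (proper (y ∷ xs))
proper-∷⁻ x y _ p with x ≟ y
... | no x≢y = x≢y , p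

proper-tail : ∀ {n} x (xs : Vec (Fin 3) n) → T (proper (x ∷ xs)) → T (proper xs)
proper-tail x []       _ = _
proper-tail x (y ∷ ys) p = proj₂ (proper-∷⁻ x y ys p)

proper-∷ʳ : ∀ {n z} (w : Vec (Fin 3) (suc n)) → T (proper w) → last w ≢ z → T (proper (w ∷ʳ z))
proper-∷ʳ (x ∷ [])     _ x≢z = proper-∷⁺ [] x≢z _
proper-∷ʳ {z = z} (x ∷ y ∷ ys) p y≢z =
  proper-∷⁺ (ys ∷ʳ z) (proj₁ (proper-∷⁻ x y ys p)) (proper-∷ʳ (y ∷ ys) (proj₂ (proper-∷⁻ x y ys p)) y≢z)

proper-push : ∀ {n z} (w : Vec (Fin 3) (suc n)) → T (proper w) → last w ≢ z → T (proper (push w z))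
proper-push {z = z} (x ∷ xs) p x≢z = proper-tail x (xs ∷ʳ z) (proper-∷ʳ (x ∷ xs) p x≢z)

alternate : Fin 3 → Fin 3 → ∀ k → Vec (Fin 3) k
alternate a b zero    = []
alternate a b (suc k) = a ∷ alternate b a k

alternate-proper : ∀ {a b} → a ≢ b → ∀ k → T (proper (alternate a b k))
alternate-proper a≢b zero          = _
alternate-proper a≢b (suc zero)    = _
alternate-proper {a} {b} a≢b (suc (suc k)) =
  proper-∷⁺ (alternate a b k) a≢b (alternate-proper (a≢b ∘ sym) (suc k))

vertex-≡ : ∀ {n} {u v : FVertex n} → sign u ≡ sign v → word u ≡ word v → u ≡ v
vertex-≡ {u = s ∶ w ⟨ p ⟩} {.s ∶ .w ⟨ q ⟩} refl refl = cong (s ∶ w ⟨_⟩) (T-irrelevant p q)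

_≟ᵛ_ : ∀ {n} → DecidableEquality (FVertex n)
u ≟ᵛ v = map′ (λ (e₁ , e₂) → vertex-≡ e₁ e₂) (λ u≡v → cong sign u≡v , cong word u≡v)
              (sign u ≟ᵇ sign v ×-dec ≡-dec _≟_ (word u) (word v))

flip : ∀ {n} → FVertex n → FVertex n
flip (s ∶ w ⟨ p ⟩) = not s ∶ w ⟨ p ⟩

arc : ∀ {m} → FVertex (suc m) → FVertex (suc m)
arc (s ∶ x ∷ xs ⟨ p ⟩) = s ∶ shift s (x ∷ xs) ⟨ proper-push (x ∷ xs) p (addSign-≢ s _) ⟩

successors : ∀ {m} → FVertex (suc m) → List (FVertex (suc m))
successors u = flip u List.∷ arc u List.∷ List.[]

successor⇒step : ∀ {m} {u v : FVertex (suc m)} → v ∈ successors u → Step (F (suc m)) u v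
successor⇒step {u = s ∶ x ∷ xs ⟨ p ⟩} (here refl)         = inj₁ (refl , refl)
successor⇒step {u = s ∶ x ∷ xs ⟨ p ⟩} (there (here refl)) = inj₂ (inj₂ (refl , refl))

step⇒successor : ∀ {m} {u v : FVertex (suc m)} → Step (F (suc m)) u v → v ∈ successors u
step⇒successor {u = s ∶ x ∷ xs ⟨ p ⟩} (inj₁ (s′≡ , w′≡)) = here (vertex-≡ s′≡ w′≡)
step⇒successor {u = s ∶ x ∷ xs ⟨ p ⟩} {v} (inj₂ (inj₁ (s≡ , w≡))) =
  here (vertex-≡ (sym (trans (cong not s≡) (not-involutive (sign v)))) (sym w≡))
step⇒successor {u = s ∶ x ∷ xs ⟨ p ⟩} (inj₂ (inj₂ (s′≡ , w′≡))) = there (here (vertex-≡ s′≡ w′≡))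

walkF? : ∀ {m} k (u v : FVertex (suc m)) → Dec (Walk (F (suc m)) k u v)
walkF? = walk? _≟ᵛ_ successors successor⇒step step⇒successor

runStep : ℕ → Fin 3 → ℕ
runStep r       one  = suc r
runStep r       two  = zero
runStep zero    zero = zero
runStep (suc r) zero = suc (suc r)

runFrom : ∀ {n} → ℕ → Vec (Fin 3) n → ℕ
runFrom = foldl′ runStep

run : ∀ {n} → Vec (Fin 3) n → ℕ
run = runFrom 0

runStep-mono : ∀ {r r′} x → r ≤ r′ → runStep r x ≤ runStep r′ x
runStep-mono one           r≤r′       = s≤s r≤r′
runStep-mono two           _          = z≤n
runStep-mono {zero}  zero  _          = z≤n
runStep-mono {suc r} zero  (s≤s r≤r′) = s≤s (s≤s r≤r′)

runFrom-mono : ∀ {n r r′} (w : Vec (Fin 3) n) → r ≤ r′ → runFrom r w ≤ runFrom r′ w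
runFrom-mono []       r≤r′ = r≤r′
runFrom-mono (x ∷ xs) r≤r′ = runFrom-mono xs (runStep-mono x r≤r′)

runFrom-last-two : ∀ {n r} (w : Vec (Fin 3) (suc n)) → last w ≡ two → runFrom r w ≡ 0
runFrom-last-two (x ∷ [])     refl = refl
runFrom-last-two (x ∷ y ∷ ys) eq   = runFrom-last-two (y ∷ ys) eq

runStep-zero-≤ : ∀ r → runStep r zero ≤ suc r
runStep-zero-≤ zero    = z≤n
runStep-zero-≤ (suc r) = ≤-refl

runFrom-alternate-zero-two : ∀ k → runFrom 0 (alternate zero two k) ≡ 0
runFrom-alternate-two-zero : ∀ k → runFrom 0 (alternate two zero k) ≡ 0
runFrom-alternate-zero-two zero    = refl
runFrom-alternate-zero-two (suc k) = runFrom-alternate-two-zero k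
runFrom-alternate-two-zero zero    = refl
runFrom-alternate-two-zero (suc k) = runFrom-alternate-zero-two k

runFrom-alternate-one-zero : ∀ r k → runFrom r (alternate one zero k) ≡ r + k
runFrom-alternate-zero-one : ∀ r k → runFrom (suc r) (alternate zero one k) ≡ suc r + k
runFrom-alternate-one-zero r zero    = sym (+-identityʳ r)
runFrom-alternate-one-zero r (suc k) = trans (runFrom-alternate-zero-one r k) (sym (+-suc r k))
runFrom-alternate-zero-one r zero    = sym (+-identityʳ (suc r))
runFrom-alternate-zero-one r (suc k) =
  trans (runFrom-alternate-one-zero (suc (suc r)) k) (cong suc (sym (+-suc r k)))

weight : ℕ → ℕ
weight zero    = 1
weight (suc r) = 2 * suc r

weight-≥1 : ∀ r → 1 ≤ weight r
weight-≥1 zero    = ≤-refl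
weight-≥1 (suc r) = s≤s z≤n

weight-step : ∀ {j r} → j ≤ suc r → weight j ≤ 2 + weight r
weight-step {zero}             _         = s≤s z≤n
weight-step {suc zero} {zero}  _         = n≤1+n _
weight-step {suc j}    {suc r} (s≤s j≤r) =
  ≤-trans (*-monoʳ-≤ 2 (s≤s j≤r)) (≤-reflexive (*-suc 2 (suc r)))

readySign : Fin 3 → Sign
readySign zero    = true
readySign (suc _) = false

-- 1 exactly when the sign is readySign of the last letter, i.e. when the arc out of the vertex
-- lengthens the run (or starts one after a 2).
ready : Sign → Fin 3 → ℕ
ready s c = flips s (not (readySign c))

arc-gain : ∀ s c {r₀ r} → r₀ ≤ r → (c ≡ two → r ≡ 0) →
           ready s (addSign s c) + weight (runStep r₀ (addSign s c)) ≤ suc (ready s c + weight r)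
arc-gain true  zero        r₀≤r _ = weight-step (s≤s r₀≤r)
arc-gain false zero {r = r} _    _ = s≤s (weight-≥1 r)
arc-gain true  one          _    _ = s≤s z≤n
arc-gain false one  {r₀}    r₀≤r _ = weight-step (≤-trans (runStep-zero-≤ r₀) (s≤s r₀≤r))
arc-gain true  two  r₀≤r last-two with last-two refl
... | refl with r₀≤r
...   | z≤n = ≤-refl
arc-gain false two  r₀≤r last-two with last-two refl
... | refl with r₀≤r
...   | z≤n = ≤-refl

potential : ∀ {m} → FVertex (suc m) → ℕ
potential v = ready (sign v) (last (word v)) + weight (run (word v))

potential-flip : ∀ {m} (u : FVertex (suc m)) → potential (flip u) ≤ suc (potential u)
potential-flip (s ∶ w ⟨ _ ⟩) =
  +-monoˡ-≤ (weight (run w)) (≤-trans (flips-≤1 (not s) _) (s≤s z≤n))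

potential-arc : ∀ {m} (u : FVertex (suc m)) → potential (arc u) ≤ suc (potential u)
potential-arc (s ∶ x ∷ xs ⟨ _ ⟩) = begin
  ready s (last (xs ∷ʳ z)) + weight (run (xs ∷ʳ z))
    ≡⟨ cong₂ (λ c′ r → ready s c′ + weight r) (last-∷ʳ z xs) (foldl-∷ʳ (λ _ → ℕ) runStep 0 z xs) ⟩
  ready s z + weight (runStep (run xs) z)
    ≤⟨ arc-gain s c (runFrom-mono xs z≤n) (runFrom-last-two (x ∷ xs)) ⟩
  suc (ready s c + weight (run (x ∷ xs))) ∎
  where
  open ≤-Reasoning
  c = last (x ∷ xs)
  z = addSign s c

potential-step : ∀ {m} (u v : FVertex (suc m)) → Step (F (suc m)) u v → potential v ≤ suc (potential u)
potential-step u v st with step⇒successor {u = u} {v} st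
... | here v≡         = subst (λ v → potential v ≤ suc (potential u)) (sym v≡) (potential-flip u)
... | there (here v≡) = subst (λ v → potential v ≤ suc (potential u)) (sym v≡) (potential-arc u)

source target : ∀ m → FVertex (suc m)
source m = not (readySign (last x)) ∶ x ⟨ alternate-proper {zero} {two} (λ ()) (suc m) ⟩
  where x = alternate zero two (suc m)
target m = readySign (last y) ∶ y ⟨ alternate-proper {one} {zero} (λ ()) (suc m) ⟩
  where y = alternate one zero (suc m)

potential-source : ∀ m → potential (source m) ≡ 1
potential-source m = cong₂ (λ f r → f + weight r) (flips-refl _) (runFrom-alternate-zero-two (suc m))

potential-target : ∀ m → potential (target m) ≡ suc (2 * suc m)
potential-target m = cong₂ (λ f r → f + weight r) (flips-not _) (runFrom-alternate-one-zero 0 (suc m))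

source-target-≥ : ∀ {m d} → Walk (F (suc m)) d (source m) (target m) → 2 * suc m ≤ d
source-target-≥ {m} {d} p =
  ≤-pred (subst₂ _≤_ (potential-target m) (cong (_+ d) (potential-source m))
                     (walk-potential-≤ potential potential-step p))

writeCost : ∀ {k} → Sign → Fin 3 → Vec (Fin 3) k → Sign → ℕ
writeCost s c []       b = flips s b
writeCost s c (z ∷ zs) b = flips s (signFor c z) + suc (writeCost (signFor c z) z zs b)

writeCost-∷-≤ : ∀ {k} s c z (zs : Vec (Fin 3) k) b →
                writeCost s c (z ∷ zs) b ≤ 2 + writeCost (signFor c z) z zs b
writeCost-∷-≤ s c z zs b = +-monoˡ-≤ _ (flips-≤1 s (signFor c z))

writeCost-≤ : ∀ {k} s c (zs : Vec (Fin 3) k) b → writeCost s c zs b ≤ suc (2 * k)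
writeCost-≤ s c []               b = flips-≤1 s b
writeCost-≤ s c (_∷_ {k} z zs) b =
  ≤-trans (writeCost-∷-≤ s c z zs b)
    (≤-trans (+-monoʳ-≤ 2 (writeCost-≤ (signFor c z) z zs b)) (≤-reflexive (cong suc (sym (*-suc 2 k)))))

resign : ∀ {n} (u v : FVertex n) → word v ≡ word u → Walk (F n) (flips (sign u) (sign v)) u v
resign (true  ∶ _ ⟨ _ ⟩) (true  ∶ _ ⟨ _ ⟩) v≡u = subst (Walk _ 0 _) (vertex-≡ refl (sym v≡u)) here
resign (true  ∶ _ ⟨ _ ⟩) (false ∶ _ ⟨ _ ⟩) v≡u = inj₁ (refl , v≡u) ∷w here
resign (false ∶ _ ⟨ _ ⟩) (true  ∶ _ ⟨ _ ⟩) v≡u = inj₁ (refl , v≡u) ∷w here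
resign (false ∶ _ ⟨ _ ⟩) (false ∶ _ ⟨ _ ⟩) v≡u = subst (Walk _ 0 _) (vertex-≡ refl (sym v≡u)) here

write : ∀ {m k} (u : FVertex (suc m)) {c} → last (word u) ≡ c →
        (zs : Vec (Fin 3) k) (v : FVertex (suc m)) →
        T (proper (c ∷ zs)) → word v ≡ pushAll (word u) zs →
        Walk (F (suc m)) (writeCost (sign u) c zs (sign v)) u v
write u refl [] v _ v≡u = resign u v v≡u
write {m} u@(s ∶ x ∷ xs ⟨ p ⟩) refl (z ∷ zs) v proper-czs v≡ =
  resign u u′ refl ++ʷ (arc-u′ ∷w write u″ (last-push (x ∷ xs) z) zs v proper-zs v≡)
  where
  c = last (x ∷ xs)
  c≢z = proj₁ (proper-∷⁻ c z zs proper-czs)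
  proper-zs = proper-tail c (z ∷ zs) proper-czs
  r = signFor c z
  u′ u″ : FVertex (suc m)
  u′ = r ∶ x ∷ xs ⟨ p ⟩
  u″ = r ∶ xs ∷ʳ z ⟨ proper-push (x ∷ xs) p c≢z ⟩
  arc-u′ : Step (F (suc m)) u′ u″
  arc-u′ = inj₂ (inj₂ (refl , cong (xs ∷ʳ_) (sym (addSign-signFor c≢z))))

direct-or-detour : ∀ s r₁ r₂ T →
  flips s r₁ + suc (flips r₁ r₂ + suc T) ≤ 3 + T ⊎
  flips s (not r₁) + suc (flips (not r₁) (not r₁) + suc (flips (not r₁) r₂ + suc T)) ≤ 3 + T
direct-or-detour true  true  true  T = inj₁ (n≤1+n _)
direct-or-detour true  true  false T = inj₁ ≤-refl
direct-or-detour true  false true  T = inj₂ ≤-refl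
direct-or-detour true  false false T = inj₁ ≤-refl
direct-or-detour false false false T = inj₁ (n≤1+n _)
direct-or-detour false false true  T = inj₁ ≤-refl
direct-or-detour false true  false T = inj₂ ≤-refl
direct-or-detour false true  true  T = inj₁ ≤-refl

within-budget : ∀ k {L T} → T ≤ suc (2 * k) → L ≤ 3 + T → L ≤ 2 * (2 + k)
within-budget k T≤ L≤ = ≤-trans L≤ (≤-trans (+-monoʳ-≤ 3 T≤)
  (≤-reflexive (sym (trans (*-suc 2 (suc k)) (cong (2 +_) (*-suc 2 k))))))

short-walk : ∀ {k} (u v : FVertex (2 + k)) → ∃[ L ] (Walk (F (2 + k)) L u v × L ≤ 2 * (2 + k))
short-walk {k} u v@(b ∶ y₁ ∷ y₂ ∷ ys ⟨ q ⟩) with last (word u) ≟ y₁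
... | yes c≡y₁ =
  _ , write u c≡y₁ (y₂ ∷ ys) v q (sym (trans (pushAll-last (word u) _) (cong (_∷ _) c≡y₁))) ,
  within-budget k (writeCost-≤ (signFor y₁ y₂) y₂ ys b) (≤-trans (writeCost-∷-≤ (sign u) y₁ y₂ ys b) (n≤1+n _))
... | no c≢y₁ with direct-or-detour (sign u) (signFor c y₁) r₂ rest | third-spec c≢y₁
  where
  c = last (word u)
  r₂ = signFor y₁ y₂
  rest = writeCost r₂ y₂ ys b
...   | inj₁ direct | _ =
  _ , write u refl (y₁ ∷ y₂ ∷ ys) v (proper-∷⁺ (y₂ ∷ ys) c≢y₁ q) (sym (pushAll-replace (word u) _)) ,
  within-budget k (writeCost-≤ (signFor y₁ y₂) y₂ ys b) direct
...   | inj₂ detour | c≢t , t≢y₁ , sign-ct , sign-ty₁ =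
  _ , write u refl (t ∷ y₁ ∷ y₂ ∷ ys) v (proper-∷⁺ (y₁ ∷ y₂ ∷ ys) c≢t (proper-∷⁺ (y₂ ∷ ys) t≢y₁ q))
        (sym (pushAll-replace (push (word u) t) _)) ,
  within-budget k (writeCost-≤ r₂ y₂ ys b) (subst (_≤ 3 + rest) (sym (cong₂ cost sign-ct sign-ty₁)) detour)
  where
  t = third (last (word u)) y₁
  r₂ = signFor y₁ y₂
  rest = writeCost r₂ y₂ ys b
  cost : Sign → Sign → ℕ
  cost r r′ = flips (sign u) r + suc (flips r r′ + suc (flips r′ r₂ + suc rest))

mainTheorem1 : ∀ (n : ℕ) → 2 ≤ n → HasDiameter (F n) (2 * n)
mainTheorem1 zero ()
mainTheorem1 (suc zero) (s≤s ())
mainTheorem1 (suc (suc k)) _ = distance-≤ , source (suc k) , target (suc k) , extremal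
  where
  distance-≤ : ∀ u v → ∃[ d ] (IsDist (F (2 + k)) u v d × d ≤ 2 * (2 + k))
  distance-≤ u v with short-walk u v
  ... | L , p , L≤ with least (λ j → walkF? j u v) L p
  ...   | d , dist , d≤L = d , dist , ≤-trans d≤L L≤
  extremal : IsDist (F (2 + k)) (source (suc k)) (target (suc k)) (2 * (2 + k))
  extremal with distance-≤ (source (suc k)) (target (suc k))
  ... | d , dist , d≤ with ≤-antisym d≤ (source-target-≥ (proj₁ dist))
  ...   | refl = dist
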